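{- For any nonempty finite set $S_L$ of positive integers, there is a set $S_R$ of positive integers with $|S_R|=|S_L|$ and $S_R\cap S_L=\emptyset$ such that Left does not strongly dominate the game $(S_L,S_R)$ (i.e. there are infinitely many $n$ with $o(n)\ne\mathcal L$).
   Context: A partizan subtraction game $(S_L,S_R)$, with $S_L,S_R$ finite sets of positive integers, is played on a heap of $n$ tokens. Two players, Left and Right, alternate moves; Left removes $s\in S_L$ tokens and Right removes $s\in S_R$ tokens (at most the current heap size). A player unable to move loses. The outcome $o(n)$ is $\mathcal L$ (Left wins whoever starts), $\mathcal R$ (Right wins whoever starts), $\mathcal N$ (first player wins) or $\mathcal P$ (second player wins). Left strongly dominates if $o(n)=\mathcal L$ for all sufficiently large $n$. -}

module Defs where

open import Data.Nat using (ℕ; zero; suc; _∸_; _≤ᵇ_)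
open import Data.Bool using (Bool; true; false; not; _∧_; _∨_; if_then_else_)
open import Data.List using (List; []; _∷_)
open import Data.Bool.ListAction using (any)

-- A subtraction set is represented as a list of natural numbers
-- (hypotheses in the statement require distinct, positive entries).

data Outcome : Set where
  𝓛 𝓡 𝓝 𝓟 : Outcome

-- Computed with fuel; fuel (suc n) is
-- sufficient on heap n because all moves remove at least one token.
moverWinsF : ℕ → List ℕ → List ℕ → ℕ → Bool
moverWinsF zero    mine theirs n = false
moverWinsF (suc f) mine theirs n =
  any (λ s → (s ≤ᵇ n) ∧ not (moverWinsF f theirs mine (n ∸ s))) mine

leftWinsFirst : List ℕ → List ℕ → ℕ → Bool
leftWinsFirst SL SR n = moverWinsF (suc n) SL SR n

rightWinsFirst : List ℕ → List ℕ → ℕ → Bool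
rightWinsFirst SL SR n = moverWinsF (suc n) SR SL n

outcome : List ℕ → List ℕ → ℕ → Outcome
outcome SL SR n with leftWinsFirst SL SR n | rightWinsFirst SL SR n
... | true  | false = 𝓛
... | false | true  = 𝓡
... | true  | true  = 𝓝
... | false | false = 𝓟

-- Take P > 2 max S_L and S_R = {P − s : s ∈ S_L}.  These moves are
-- large, pairwise distinct and disjoint from S_L, and they give Right a mirror strategy:
-- whenever Left removes s from a heap that is a multiple of P, Right removes P − s and
-- restores a multiple of P.  Left, who cannot move from the empty heap, therefore loses
-- every heap jP when moving first, so o(jP) ≠ 𝓛 for all j.
module Submission where

open import Defs
open import Level using (Level)
open import Data.Nat using (ℕ; zero; suc; _+_; _*_; _∸_; _≤_; _<_; z≤n; s≤s)
open import Data.Nat.Properties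
open import Data.Nat.ListAction using (sum)
open import Data.Bool using (Bool; true; false; not; T)
open import Data.Bool.Properties using (T-∧)
open import Data.Unit using (tt)
open import Data.List using (List; []; _∷_; length; map)
open import Data.List.Properties using (length-map)
open import Data.List.Relation.Unary.All using (All; []; _∷_)
import Data.List.Relation.Unary.All as All
import Data.List.Relation.Unary.All.Properties as All
open import Data.List.Relation.Unary.Any using (here; there)
open import Data.List.Relation.Unary.Any.Properties using (any⁺; any⁻)
open import Data.List.Relation.Unary.Unique.Propositional using (Unique)
open import Data.List.Relation.Unary.AllPairs using ([]; _∷_)
open import Data.List.Membership.Propositional using (_∈_; _∉_; find; lose)
open import Data.List.Membership.Propositional.Properties using (∈-map⁺; ∈-map⁻)
open import Data.Product using (Σ; _×_; _,_; proj₁; proj₂; ∃-syntax)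
open import Function using (_∘_; Equivalence)
open import Relation.Nullary using (¬_)
open import Relation.Unary using (Pred)
open import Relation.Binary.PropositionalEquality using (_≡_; _≢_; refl; sym; subst)

private
  variable
    a b p : Level
    A : Set a
    B : Set b

T-not⁺ : ∀ {x} → ¬ T x → T (not x)
T-not⁺ {false} _  = tt
T-not⁺ {true}  ¬t = ¬t tt

T-not⁻ : ∀ {x} → T (not x) → ¬ T x
T-not⁻ {false} _ ()

winningMove : ∀ f mine theirs {n} → T (moverWinsF (suc f) mine theirs n) →
  ∃[ s ] (s ∈ mine × s ≤ n × ¬ T (moverWinsF f theirs mine (n ∸ s)))
winningMove f mine theirs {n} wins with find (any⁻ _ _ wins)
... | s , s∈mine , legalAndWinning with Equivalence.to T-∧ legalAndWinning
... | legal , opponentLoses = s , s∈mine , ≤ᵇ⇒≤ s n legal , T-not⁻ opponentLoses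

winsByMove : ∀ f mine theirs {n s} → s ∈ mine → s ≤ n →
  ¬ T (moverWinsF f theirs mine (n ∸ s)) → T (moverWinsF (suc f) mine theirs n)
winsByMove f mine theirs s∈mine s≤n opponentLoses =
  any⁺ _ (lose s∈mine (Equivalence.from T-∧ (≤⇒≤ᵇ s≤n , T-not⁺ opponentLoses)))

outcome≡𝓛⇒leftWinsFirst : ∀ SL SR n → outcome SL SR n ≡ 𝓛 → T (leftWinsFirst SL SR n)
outcome≡𝓛⇒leftWinsFirst SL SR n with leftWinsFirst SL SR n | rightWinsFirst SL SR n
... | true  | _     = λ _ → tt
... | false | true  = λ ()
... | false | false = λ ()

module MirrorStrategy (SL SR : List ℕ) (P : ℕ)
  (SL-pos : ∀ {s} → s ∈ SL → 0 < s)
  (answer : ∀ {s} → s ∈ SL → s < P × P ∸ s ∈ SR) where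

  leftFirstLoses : ∀ f j → j * P < f → ¬ T (moverWinsF f SL SR (j * P))
  rightFirstWinsAfter : ∀ f j {s} → s ∈ SL → P + j * P ∸ s < f →
    T (moverWinsF f SR SL (P + j * P ∸ s))

  leftFirstLoses (suc f) zero _ wins with winningMove f SL SR wins
  ... | s , s∈SL , s≤0 , _ = <⇒≱ (SL-pos s∈SL) s≤0
  leftFirstLoses (suc f) (suc j) n<1+f wins with winningMove f SL SR wins
  ... | s , s∈SL , s≤n , rightLoses =
    rightLoses (rightFirstWinsAfter f j s∈SL (<-≤-trans (∸-monoʳ-< (SL-pos s∈SL) s≤n) (≤-pred n<1+f)))

  rightFirstWinsAfter (suc f) j {s} s∈SL h<1+f
    rewrite +-∸-comm (j * P) (<⇒≤ (proj₁ (answer s∈SL))) =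
    winsByMove f SR SL (proj₂ (answer s∈SL)) (m≤m+n t (j * P)) leftLoses
    where
    t : ℕ
    t = P ∸ s

    jP<f : j * P < f
    jP<f = ≤-pred (≤-trans (s≤s (+-monoˡ-≤ (j * P) (m<n⇒0<n∸m (proj₁ (answer s∈SL))))) h<1+f)

    leftLoses : ¬ T (moverWinsF f SL SR (t + j * P ∸ t))
    leftLoses = subst (λ m → ¬ T (moverWinsF f SL SR m)) (sym (m+n∸m≡n t (j * P))) (leftFirstLoses f j jP<f)

unique-map⁺-injectiveOn : {P : Pred A p} {f : A → B} {xs : List A} →
  (∀ {x y} → P x → P y → f x ≡ f y → x ≡ y) → All P xs → Unique xs → Unique (map f xs)
unique-map⁺-injectiveOn inj [] [] = []
unique-map⁺-injectiveOn inj (px ∷ pxs) (x∉xs ∷ xs!) =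
  All.map⁺ (All.zipWith (λ (py , x≢y) fx≡fy → x≢y (inj px py fx≡fy)) (pxs , x∉xs))
  ∷ unique-map⁺-injectiveOn inj pxs xs!

∈⇒≤sum : ∀ {s xs} → s ∈ xs → s ≤ sum xs
∈⇒≤sum {s} {_ ∷ xs} (here refl) = m≤m+n s (sum xs)
∈⇒≤sum {xs = x ∷ _} (there s∈xs) = ≤-trans (∈⇒≤sum s∈xs) (m≤n+m _ x)

mainTheorem8 : (SL : List ℕ) → Unique SL → All (λ s → 0 < s) SL → 0 < length SL →
    Σ (List ℕ) (λ SR → Unique SR × All (λ s → 0 < s) SR × length SR ≡ length SL ×
      (∀ s → s ∈ SR → s ∉ SL) ×
      (∀ N → ∃[ n ] (N ≤ n × outcome SL SR n ≢ 𝓛)))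
mainTheorem8 SL SL-unique SL-pos _ =
  SR , unique-map⁺-injectiveOn ∸-cancelˡ-≡ (All.tabulate (<⇒≤ ∘ below)) SL-unique ,
  All.tabulate (λ t∈SR → ≤-trans (s≤s z≤n) (above t∈SR)) ,
  length-map (P ∸_) SL , disjoint , notLeft
  where
  M P : ℕ
  M = sum SL
  P = suc (M + M)

  SR : List ℕ
  SR = map (P ∸_) SL

  below : ∀ {s} → s ∈ SL → s < P
  below s∈SL = s≤s (≤-trans (∈⇒≤sum s∈SL) (m≤m+n M M))

  above : ∀ {t} → t ∈ SR → M < t
  above t∈SR with ∈-map⁻ (P ∸_) t∈SR
  ... | s , s∈SL , refl = ≤-trans (≤-reflexive (sym (m+n∸n≡m (suc M) M))) (∸-monoʳ-≤ P (∈⇒≤sum s∈SL))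

  disjoint : ∀ t → t ∈ SR → t ∉ SL
  disjoint t t∈SR t∈SL = <⇒≱ (above t∈SR) (∈⇒≤sum t∈SL)

  open MirrorStrategy SL SR P (All.lookup SL-pos) (λ s∈SL → below s∈SL , ∈-map⁺ (P ∸_) s∈SL)

  notLeft : ∀ N → ∃[ n ] (N ≤ n × outcome SL SR n ≢ 𝓛)
  notLeft N = N * P , m≤m*n N P ,
    leftFirstLoses (suc (N * P)) N ≤-refl ∘ outcome≡𝓛⇒leftWinsFirst SL SR (N * P)
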